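{- Let $G$ be a simple graph on $n$ vertices and let $J$ be a symmetric subgraph of $K_{n,n}$. Let $G^1,G^2,\dots$ be the self-similar graphs based on $(G,J)$. Then for every $k\ge 1$ and every vertex $(u_1,\dots,u_k)$ of $G^k$, $$d_{G^k}(u_1,u_2,\dots,u_k) = d_G(u_k) + \sum_{i=1}^{k-1} d_G(u_{k-i}) \prod_{l=0}^{i-1} d_J(u_{k-l}),$$ where for a vertex $v_m$ of $G$, $d_J(v_m)$ denotes the degree of the vertex $m$ in $J$.
   Context: Let $G$ be a simple graph with vertex set $V(G)=\{v_1,\dots,v_n\}$. Let $K_{n,n}$ be the complete bipartite graph with parts $I_n=\{1,\dots,n\}$ and $I_n'=\{1',\dots,n'\}$. A subgraph $J$ of $K_{n,n}$ with vertex set $I_n\cup I_n'$ is symmetric if $i\sim j'$ in $J$ if and only if $j \sim i'$ in $J$ (so the vertex $m$ and the vertex $m'$ have the same degree in $J$). The self-similar graphs based on $(G,J)$ are defined recursively: $G^1=G$; for $k\ge 2$, $V(G^k)=V(G)^k$, and $(v_{i_1},\dots,v_{i_k})\sim(v_{j_1},\dots,v_{j_k})$ in $G^k$ if and only if either (1) $(v_{i_1},\dots,v_{i_{k-1}})=(v_{j_1},\dots,v_{j_{k-1}})$ and $v_{i_k}\sim v_{j_k}$ in $G$, or (2) $(v_{i_1},\dots,v_{i_{k-1}})\sim(v_{j_1},\dots,v_{j_{k-1}})$ in $G^{k-1}$ and $i_k\sim j_k'$ in $J$. $d_H(x)$ denotes the degree of $x$ in the graph $H$. -}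

module Defs where

open import Data.Nat using (ℕ; zero; suc; _+_; _*_; _∸_)
open import Data.Bool using (Bool; true; false; _∧_; _∨_; if_then_else_)
open import Data.Fin using (Fin)
open import Data.Fin.Properties using () renaming (_≟_ to _≟F_)
open import Data.List using (List; map; allFin)
open import Data.Nat.ListAction using (sum)
open import Data.Vec using (Vec; []; _∷_; init; last)
open import Data.Vec.Properties using (≡-dec)
open import Relation.Nullary.Decidable using (⌊_⌋)
open import Relation.Binary.PropositionalEquality using (_≡_)

-- A simple graph on vertex set Fin n (vertex i stands for v_{i+1}):
-- decidable (Bool-valued) adjacency, symmetric, loopless.
record SimpleGraph (n : ℕ) : Set where
  field
    adj   : Fin n → Fin n → Bool
    sym   : ∀ i j → adj i j ≡ adj j i
    irrefl : ∀ i → adj i i ≡ false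
open SimpleGraph public

-- A symmetric spanning subgraph J of K_{n,n}: edge i ~ j' iff  edge i j ≡ true,
-- with the symmetry condition  i ~ j'  iff  j ~ i'.
record SymBipartite (n : ℕ) : Set where
  field
    edge : Fin n → Fin n → Bool
    symm : ∀ i j → edge i j ≡ edge j i
open SymBipartite public

count : {A : Set} → List A → (A → Bool) → ℕ
count xs P = sum (map (λ x → if P x then 1 else 0) xs)

degG : ∀ {n} → SimpleGraph n → Fin n → ℕ
degG {n} G v = count (allFin n) (adj G v)

degJ : ∀ {n} → SymBipartite n → Fin n → ℕ
degJ {n} J m = count (allFin n) (edge J m)

_=ᵛ_ : ∀ {n k} → Vec (Fin n) k → Vec (Fin n) k → Bool
u =ᵛ v = ⌊ ≡-dec _≟F_ u v ⌋

-- adjacency in the self-similar graph G^(suc m), vertices Vec (Fin n) (suc m)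
adjPow : ∀ {n} → SimpleGraph n → SymBipartite n → (m : ℕ) →
         Vec (Fin n) (suc m) → Vec (Fin n) (suc m) → Bool
adjPow G J zero (a ∷ []) (b ∷ []) = adj G a b
adjPow G J (suc m) u v =
  ((init u =ᵛ init v) ∧ adj G (last u) (last v))
  ∨ (adjPow G J m (init u) (init v) ∧ edge J (last u) (last v))

countVec : ∀ {n} (k : ℕ) → (Vec (Fin n) k → Bool) → ℕ
countVec zero P = if P [] then 1 else 0
countVec {n} (suc k) P = sum (map (λ i → countVec k (λ v → P (i ∷ v))) (allFin n))

degPow : ∀ {n} → SimpleGraph n → SymBipartite n → (m : ℕ) → Vec (Fin n) (suc m) → ℕ
degPow G J m u = countVec (suc m) (adjPow G J m u)

-- 1-based access u_j to a nonempty tuple (u_1,...,u_k); out of range indices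
-- (never used) fall back to u_1.
nth : ∀ {A : Set} {k} → Vec A (suc k) → ℕ → A
nth {A} (x ∷ xs) j = go (x ∷ xs) (j ∸ 1)
  where
  go : ∀ {l} → Vec A l → ℕ → A
  go [] _ = x
  go (y ∷ ys) zero = y
  go (y ∷ ys) (suc i) = go ys i

sumFromTo : ℕ → ℕ → (ℕ → ℕ) → ℕ
sumFromTo a b f = go (suc b ∸ a)
  where
  go : ℕ → ℕ
  go zero = 0
  go (suc c) = go c + f (a + c)

prodFromTo : ℕ → ℕ → (ℕ → ℕ) → ℕ
prodFromTo a b f = go (suc b ∸ a)
  where
  go : ℕ → ℕ
  go zero = 1
  go (suc c) = go c * f (a + c)

-- Splitting a vertex of G^(k+1) as (w, a), its neighbours are the (w, b) with a ~ b in G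
-- and the (w', b) with w ~ w' in G^k and a ~ b' in J; the two kinds are disjoint since
-- G^k is loopless. Hence d_{G^(k+1)}(w, a) = d_G(a) + d_{G^k}(w) d_J(a), and unrolling
-- this Horner-type recursion gives the closed formula.
module Submission where

open import Defs hiding (sym)
open import Data.Bool using (Bool; true; false; _∧_; _∨_; if_then_else_)
open import Data.Bool.Properties using (∧-zeroʳ)
open import Data.Fin using (Fin; punchIn)
open import Data.Fin.Properties using (punchInᵢ≢i) renaming (_≟_ to _≟F_)
open import Data.List using (map; allFin; tabulate)
open import Data.List.Properties using (map-tabulate)
open import Data.Nat using (ℕ; zero; suc; _+_; _*_; _∸_; _≤_; s≤s)
open import Data.Nat.ListAction using (sum)
open import Data.Nat.Properties
  using ( +-*-semiring; +-identityʳ; +-assoc; +-comm; *-identityˡ; *-comm; *-assoc; *-distribʳ-+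
        ; ≤-refl; m∸n≤m)
open import Algebra.Properties.Semiring.Sum +-*-semiring
  using (∑-distrib-+; *-distribˡ-sum; *-distribʳ-sum; sum-cong-≗; sum-remove; sum-replicate-zero)
  renaming (sum to ∑)
open import Data.Vec using (Vec; []; _∷_; init; last; _∷ʳ_)
open import Data.Vec.Properties using (≡-dec; init-∷ʳ; last-∷ʳ; ∷-injectiveˡ; ∷-injectiveʳ)
open import Function using (_∘_)
open import Relation.Binary.PropositionalEquality
open import Relation.Nullary using (yes; no; contradiction)

private
  variable
    n k : ℕ

indicator : Bool → ℕ
indicator b = if b then 1 else 0

indicator-∨-exclusive : ∀ b₁ c₁ b₂ c₂ → (b₁ ≡ true → b₂ ≡ false) →
  indicator ((b₁ ∧ c₁) ∨ (b₂ ∧ c₂)) ≡ indicator b₁ * indicator c₁ + indicator b₂ * indicator c₂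
indicator-∨-exclusive true  c₁    true  c₂    excl = contradiction (excl refl) λ ()
indicator-∨-exclusive true  true  false c₂    excl = refl
indicator-∨-exclusive true  false false c₂    excl = refl
indicator-∨-exclusive false c₁    true  true  excl = refl
indicator-∨-exclusive false c₁    true  false excl = refl
indicator-∨-exclusive false c₁    false c₂    excl = refl

sum-tabulate : (f : Fin n → ℕ) → sum (tabulate f) ≡ ∑ f
sum-tabulate {zero}  f = refl
sum-tabulate {suc n} f = cong (f Fin.zero +_) (sum-tabulate (f ∘ Fin.suc))

sum-map-allFin : (f : Fin n → ℕ) → sum (map f (allFin n)) ≡ ∑ f
sum-map-allFin f = trans (cong sum (map-tabulate (λ i → i) f)) (sum-tabulate f)

∑-point : ∀ (f : Fin n → ℕ) i → (∀ j → j ≢ i → f j ≡ 0) → ∑ f ≡ f i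
∑-point {suc n} f i vanish = begin
  ∑ f                      ≡⟨ sum-remove {i = i} f ⟩
  f i + ∑ (f ∘ punchIn i)  ≡⟨ cong (f i +_) (sum-cong-≗ {n} (λ j → vanish _ (punchInᵢ≢i i j))) ⟩
  f i + ∑ {n} (λ _ → 0)    ≡⟨ cong (f i +_) (sum-replicate-zero n) ⟩
  f i + 0                  ≡⟨ +-identityʳ (f i) ⟩
  f i                      ∎
  where open ≡-Reasoning

∑ᵛ : ∀ k → (Vec (Fin n) k → ℕ) → ℕ
∑ᵛ zero    f = f []
∑ᵛ (suc k) f = ∑ (λ i → ∑ᵛ k (f ∘ (i ∷_)))

countVec≡∑ᵛ : ∀ k (P : Vec (Fin n) k → Bool) → countVec k P ≡ ∑ᵛ k (indicator ∘ P)
countVec≡∑ᵛ zero    P = refl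
countVec≡∑ᵛ (suc k) P =
  trans (sum-map-allFin (λ i → countVec k (P ∘ (i ∷_))))
        (sum-cong-≗ (λ i → countVec≡∑ᵛ k (P ∘ (i ∷_))))

∑ᵛ-cong : ∀ k {f g : Vec (Fin n) k → ℕ} → (∀ v → f v ≡ g v) → ∑ᵛ k f ≡ ∑ᵛ k g
∑ᵛ-cong zero    f≗g = f≗g []
∑ᵛ-cong (suc k) f≗g = sum-cong-≗ (λ i → ∑ᵛ-cong k (f≗g ∘ (i ∷_)))

∑ᵛ-zero : ∀ k → ∑ᵛ {n} k (λ _ → 0) ≡ 0
∑ᵛ-zero {n} zero    = refl
∑ᵛ-zero {n} (suc k) = trans (sum-cong-≗ {n} (λ _ → ∑ᵛ-zero k)) (sum-replicate-zero n)

∑ᵛ-distrib-+ : ∀ k (f g : Vec (Fin n) k → ℕ) → ∑ᵛ k (λ v → f v + g v) ≡ ∑ᵛ k f + ∑ᵛ k g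
∑ᵛ-distrib-+ zero    f g = refl
∑ᵛ-distrib-+ (suc k) f g =
  trans (sum-cong-≗ (λ i → ∑ᵛ-distrib-+ k (f ∘ (i ∷_)) (g ∘ (i ∷_))))
        (∑-distrib-+ (λ i → ∑ᵛ k (f ∘ (i ∷_))) (λ i → ∑ᵛ k (g ∘ (i ∷_))))

∑ᵛ-*-distribʳ : ∀ k (f : Vec (Fin n) k → ℕ) c → ∑ᵛ k (λ v → f v * c) ≡ ∑ᵛ k f * c
∑ᵛ-*-distribʳ zero    f c = refl
∑ᵛ-*-distribʳ (suc k) f c =
  trans (sum-cong-≗ (λ i → ∑ᵛ-*-distribʳ k (f ∘ (i ∷_)) c))
        (sym (*-distribʳ-sum c (λ i → ∑ᵛ k (f ∘ (i ∷_)))))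

∑ᵛ-point : ∀ k (f : Vec (Fin n) k → ℕ) w → (∀ v → v ≢ w → f v ≡ 0) → ∑ᵛ k f ≡ f w
∑ᵛ-point zero    f []      vanish = refl
∑ᵛ-point (suc k) f (x ∷ w) vanish = trans
  (∑-point _ x (λ i i≢x → trans (∑ᵛ-cong k (λ v → vanish (i ∷ v) (i≢x ∘ ∷-injectiveˡ))) (∑ᵛ-zero k)))
  (∑ᵛ-point k (f ∘ (x ∷_)) w (λ v v≢w → vanish (x ∷ v) (v≢w ∘ ∷-injectiveʳ)))

∑ᵛ-∷ʳ : ∀ k (f : Vec (Fin n) (suc k) → ℕ) → ∑ᵛ (suc k) f ≡ ∑ᵛ k (λ w → ∑ (λ a → f (w ∷ʳ a)))
∑ᵛ-∷ʳ zero    f = refl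
∑ᵛ-∷ʳ (suc k) f = sum-cong-≗ (λ i → ∑ᵛ-∷ʳ k (f ∘ (i ∷_)))

=ᵛ-refl : (w : Vec (Fin n) k) → (w =ᵛ w) ≡ true
=ᵛ-refl w with ≡-dec _≟F_ w w
... | yes _   = refl
... | no  w≢w = contradiction refl w≢w

=ᵛ-≢ : (w v : Vec (Fin n) k) → w ≢ v → (w =ᵛ v) ≡ false
=ᵛ-≢ w v w≢v with ≡-dec _≟F_ w v
... | yes w≡v = contradiction w≡v w≢v
... | no  _   = refl

=ᵛ⇒≡ : (w v : Vec (Fin n) k) → (w =ᵛ v) ≡ true → w ≡ v
=ᵛ⇒≡ w v with ≡-dec _≟F_ w v
... | yes w≡v = λ _ → w≡v
... | no  _   = λ ()

∑ᵛ-indicator-=ᵛ : ∀ k (w : Vec (Fin n) k) → ∑ᵛ k (λ v → indicator (w =ᵛ v)) ≡ 1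
∑ᵛ-indicator-=ᵛ k w = trans
  (∑ᵛ-point k _ w (λ v v≢w → cong indicator (=ᵛ-≢ w v (v≢w ∘ sym))))
  (cong indicator (=ᵛ-refl w))

sumFromTo-peelˡ : ∀ b f → sumFromTo 1 (suc b) f ≡ f 1 + sumFromTo 1 b (f ∘ suc)
sumFromTo-peelˡ zero    f = +-comm 0 (f 1)
sumFromTo-peelˡ (suc b) f = trans (cong (_+ f (2 + b)) (sumFromTo-peelˡ b f)) (+-assoc (f 1) _ _)

prodFromTo-peelˡ : ∀ b g → prodFromTo 0 (suc b) g ≡ g 0 * prodFromTo 0 b (g ∘ suc)
prodFromTo-peelˡ zero    g =
  trans (cong (_* g 1) (*-identityˡ (g 0))) (cong (g 0 *_) (sym (*-identityˡ (g 1))))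
prodFromTo-peelˡ (suc b) g = trans (cong (_* g (2 + b)) (prodFromTo-peelˡ b g)) (*-assoc (g 0) _ _)

sumFromTo-cong : ∀ b {f g} → (∀ i → f (suc i) ≡ g (suc i)) → sumFromTo 1 b f ≡ sumFromTo 1 b g
sumFromTo-cong zero    f≗g = refl
sumFromTo-cong (suc b) f≗g = cong₂ _+_ (sumFromTo-cong b f≗g) (f≗g b)

prodFromTo-cong : ∀ b {g h} → (∀ l → g l ≡ h l) → prodFromTo 0 b g ≡ prodFromTo 0 b h
prodFromTo-cong zero    g≗h = cong (1 *_) (g≗h 0)
prodFromTo-cong (suc b) g≗h = cong₂ _*_ (prodFromTo-cong b g≗h) (g≗h (suc b))

sumFromTo-*-distribʳ : ∀ b f c → sumFromTo 1 b (λ i → f i * c) ≡ sumFromTo 1 b f * c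
sumFromTo-*-distribʳ zero    f c = refl
sumFromTo-*-distribʳ (suc b) f c = trans (cong (_+ f (suc b) * c) (sumFromTo-*-distribʳ b f c))
                                         (sym (*-distribʳ-+ c (sumFromTo 1 b f) (f (suc b))))

-- The right-hand side of the theorem, with d j and e j standing for d_G(u_j) and d_J(u_j).
closedForm : ℕ → (ℕ → ℕ) → (ℕ → ℕ) → ℕ
closedForm k d e = d k + sumFromTo 1 (k ∸ 1) (λ i → d (k ∸ i) * prodFromTo 0 (i ∸ 1) (λ l → e (k ∸ l)))

closedForm-cong : ∀ k {d d′ e e′} → (∀ j → j ≤ k → d j ≡ d′ j) → (∀ j → j ≤ k → e j ≡ e′ j) →
  closedForm k d e ≡ closedForm k d′ e′
closedForm-cong k d≗d′ e≗e′ = cong₂ _+_ (d≗d′ k ≤-refl) (sumFromTo-cong (k ∸ 1) λ i →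
  cong₂ _*_ (d≗d′ (k ∸ suc i) (m∸n≤m k (suc i)))
            (prodFromTo-cong i λ l → e≗e′ (k ∸ l) (m∸n≤m k l)))

closedForm-suc : ∀ m d e → closedForm (2 + m) d e ≡ d (2 + m) + closedForm (suc m) d e * e (2 + m)
closedForm-suc m d e = cong (d (2 + m) +_) (begin
  sumFromTo 1 (suc m) summand
    ≡⟨ sumFromTo-peelˡ m summand ⟩
  summand 1 + sumFromTo 1 m (summand ∘ suc)
    ≡⟨ cong₂ _+_ (cong (d (suc m) *_) (*-identityˡ (e (2 + m)))) (sumFromTo-cong m shifted) ⟩
  d (suc m) * e (2 + m) + sumFromTo 1 m (λ i → summand′ i * e (2 + m))
    ≡⟨ cong (d (suc m) * e (2 + m) +_) (sumFromTo-*-distribʳ m summand′ (e (2 + m))) ⟩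
  d (suc m) * e (2 + m) + sumFromTo 1 m summand′ * e (2 + m)
    ≡⟨ sym (*-distribʳ-+ (e (2 + m)) (d (suc m)) _) ⟩
  closedForm (suc m) d e * e (2 + m) ∎)
  where
  open ≡-Reasoning
  summand summand′ : ℕ → ℕ
  summand  i = d (2 + m ∸ i) * prodFromTo 0 (i ∸ 1) (λ l → e (2 + m ∸ l))
  summand′ i = d (suc m ∸ i) * prodFromTo 0 (i ∸ 1) (λ l → e (suc m ∸ l))
  shifted : ∀ t → summand (2 + t) ≡ summand′ (suc t) * e (2 + m)
  shifted t = begin
    d (m ∸ t) * prodFromTo 0 (suc t) (λ l → e (2 + m ∸ l))
      ≡⟨ cong (d (m ∸ t) *_) (prodFromTo-peelˡ t (λ l → e (2 + m ∸ l))) ⟩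
    d (m ∸ t) * (e (2 + m) * P)
      ≡⟨ cong (d (m ∸ t) *_) (*-comm (e (2 + m)) P) ⟩
    d (m ∸ t) * (P * e (2 + m))
      ≡⟨ sym (*-assoc (d (m ∸ t)) P (e (2 + m))) ⟩
    d (m ∸ t) * P * e (2 + m) ∎
    where P = prodFromTo 0 t (λ l → e (suc m ∸ l))

nth-last : ∀ {A : Set} {m} (u : Vec A (suc m)) → nth u (suc m) ≡ last u
nth-last (x ∷ [])         = refl
nth-last (x ∷ y ∷ [])     = refl
nth-last (x ∷ y ∷ z ∷ zs) = nth-last (x ∷ z ∷ zs)

nth-init : ∀ {A : Set} {m} (u : Vec A (2 + m)) j → j ≤ suc m → nth (init u) j ≡ nth u j
nth-init (x ∷ y ∷ ys)     zero                _          = refl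
nth-init (x ∷ y ∷ ys)     (suc zero)          _          = refl
nth-init (x ∷ y ∷ [])     (suc (suc j))       (s≤s ())
nth-init (x ∷ y ∷ z ∷ zs) (suc (suc zero))    _          = refl
nth-init (x ∷ y ∷ z ∷ zs) (suc (suc (suc j))) (s≤s j≤m) = nth-init (x ∷ z ∷ zs) (suc (suc j)) j≤m

module _ (G : SimpleGraph n) (J : SymBipartite n) where

  adjPow-irrefl : ∀ m (u : Vec (Fin n) (suc m)) → adjPow G J m u u ≡ false
  adjPow-irrefl zero    (a ∷ []) = irrefl G a
  adjPow-irrefl (suc m) u = cong₂ _∨_
    (trans (cong ((init u =ᵛ init u) ∧_) (irrefl G (last u))) (∧-zeroʳ _))
    (cong (_∧ edge J (last u) (last u)) (adjPow-irrefl m (init u)))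

  adjPow-suc-∷ʳ : ∀ m (u : Vec (Fin n) (suc (suc m))) w a →
    adjPow G J (suc m) u (w ∷ʳ a)
      ≡ ((init u =ᵛ w) ∧ adj G (last u) a) ∨ (adjPow G J m (init u) w ∧ edge J (last u) a)
  adjPow-suc-∷ʳ m u w a = cong₂
    (λ w′ a′ → ((init u =ᵛ w′) ∧ adj G (last u) a′) ∨ (adjPow G J m (init u) w′ ∧ edge J (last u) a′))
    (init-∷ʳ a w) (last-∷ʳ a w)

  neighbours-in-fibre : ∀ m (u : Vec (Fin n) (suc (suc m))) w →
    ∑ (λ a → indicator (adjPow G J (suc m) u (w ∷ʳ a)))
      ≡ indicator (init u =ᵛ w) * degG G (last u) + indicator (adjPow G J m (init u) w) * degJ J (last u)
  neighbours-in-fibre m u w = begin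
    ∑ (λ a → indicator (adjPow G J (suc m) u (w ∷ʳ a)))
      ≡⟨ sum-cong-≗ (λ a → trans (cong indicator (adjPow-suc-∷ʳ m u w a))
                                 (indicator-∨-exclusive _ _ _ _ exclusive)) ⟩
    ∑ (λ a → x * indicator (adj G ℓ a) + y * indicator (edge J ℓ a))
      ≡⟨ ∑-distrib-+ (λ a → x * indicator (adj G ℓ a)) (λ a → y * indicator (edge J ℓ a)) ⟩
    ∑ (λ a → x * indicator (adj G ℓ a)) + ∑ (λ a → y * indicator (edge J ℓ a))
      ≡⟨ cong₂ _+_ (sym (*-distribˡ-sum x (indicator ∘ adj G ℓ)))
                   (sym (*-distribˡ-sum y (indicator ∘ edge J ℓ))) ⟩
    x * ∑ (indicator ∘ adj G ℓ) + y * ∑ (indicator ∘ edge J ℓ)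
      ≡⟨ cong₂ _+_ (cong (x *_) (sym (sum-map-allFin (indicator ∘ adj G ℓ))))
                   (cong (y *_) (sym (sum-map-allFin (indicator ∘ edge J ℓ)))) ⟩
    x * degG G ℓ + y * degJ J ℓ ∎
    where
    open ≡-Reasoning
    ℓ = last u
    x = indicator (init u =ᵛ w)
    y = indicator (adjPow G J m (init u) w)
    exclusive : (init u =ᵛ w) ≡ true → adjPow G J m (init u) w ≡ false
    exclusive eq =
      subst (λ v → adjPow G J m (init u) v ≡ false) (=ᵛ⇒≡ (init u) w eq) (adjPow-irrefl m (init u))

  degPow-suc : ∀ m (u : Vec (Fin n) (suc (suc m))) →
    degPow G J (suc m) u ≡ degG G (last u) + degPow G J m (init u) * degJ J (last u)
  degPow-suc m u = begin
    degPow G J (suc m) u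
      ≡⟨ countVec≡∑ᵛ (suc (suc m)) (adjPow G J (suc m) u) ⟩
    ∑ᵛ (suc (suc m)) (indicator ∘ adjPow G J (suc m) u)
      ≡⟨ ∑ᵛ-∷ʳ (suc m) (indicator ∘ adjPow G J (suc m) u) ⟩
    ∑ᵛ (suc m) (λ w → ∑ (λ a → indicator (adjPow G J (suc m) u (w ∷ʳ a))))
      ≡⟨ ∑ᵛ-cong (suc m) (neighbours-in-fibre m u) ⟩
    ∑ᵛ (suc m) (λ w → is-u₀ w * dG + adj-u₀ w * dJ)
      ≡⟨ ∑ᵛ-distrib-+ (suc m) (λ w → is-u₀ w * dG) (λ w → adj-u₀ w * dJ) ⟩
    ∑ᵛ (suc m) (λ w → is-u₀ w * dG) + ∑ᵛ (suc m) (λ w → adj-u₀ w * dJ)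
      ≡⟨ cong₂ _+_ (∑ᵛ-*-distribʳ (suc m) is-u₀ dG) (∑ᵛ-*-distribʳ (suc m) adj-u₀ dJ) ⟩
    ∑ᵛ (suc m) is-u₀ * dG + ∑ᵛ (suc m) adj-u₀ * dJ
      ≡⟨ cong₂ _+_ (trans (cong (_* dG) (∑ᵛ-indicator-=ᵛ (suc m) u₀)) (*-identityˡ dG))
                   (cong (_* dJ) (sym (countVec≡∑ᵛ (suc m) (adjPow G J m u₀)))) ⟩
    dG + degPow G J m u₀ * dJ ∎
    where
    open ≡-Reasoning
    u₀ = init u
    dG = degG G (last u)
    dJ = degJ J (last u)
    is-u₀ adj-u₀ : Vec (Fin n) (suc m) → ℕ
    is-u₀ w  = indicator (u₀ =ᵛ w)
    adj-u₀ w = indicator (adjPow G J m u₀ w)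

  degPow≡closedForm : ∀ m (u : Vec (Fin n) (suc m)) →
    degPow G J m u ≡ closedForm (suc m) (degG G ∘ nth u) (degJ J ∘ nth u)
  degPow≡closedForm zero    (a ∷ []) = sym (+-identityʳ (degG G a))
  degPow≡closedForm (suc m) u = begin
    degPow G J (suc m) u
      ≡⟨ degPow-suc m u ⟩
    degG G (last u) + degPow G J m (init u) * degJ J (last u)
      ≡⟨ cong (λ c → degG G (last u) + c * degJ J (last u)) (degPow≡closedForm m (init u)) ⟩
    degG G (last u) + closedForm (suc m) (degG G ∘ nth (init u)) (degJ J ∘ nth (init u)) * degJ J (last u)
      ≡⟨ cong₂ (λ c v → degG G v + c * degJ J v)
               (closedForm-cong (suc m) (λ j j≤ → cong (degG G) (nth-init u j j≤))
                                        (λ j j≤ → cong (degJ J) (nth-init u j j≤)))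
               (sym (nth-last u)) ⟩
    degG G (nth u (2 + m)) + closedForm (suc m) (degG G ∘ nth u) (degJ J ∘ nth u) * degJ J (nth u (2 + m))
      ≡⟨ sym (closedForm-suc m (degG G ∘ nth u) (degJ J ∘ nth u)) ⟩
    closedForm (2 + m) (degG G ∘ nth u) (degJ J ∘ nth u) ∎
    where open ≡-Reasoning

proposition2p2 : (n : ℕ) (G : SimpleGraph n) (J : SymBipartite n) (m : ℕ)
    → (u : Vec (Fin n) (suc m))
    → let k = suc m in
      degPow G J m u
        ≡ degG G (nth u k)
          + sumFromTo 1 (k ∸ 1) (λ i →
              degG G (nth u (k ∸ i)) * prodFromTo 0 (i ∸ 1) (λ l → degJ J (nth u (k ∸ l))))
proposition2p2 n G J = degPow≡closedForm G J
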